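{- Let $\Gamma$ be a $z$-knotted triangulation of a connected closed $2$-dimensional surface $M$. Then for every face $F$ of $\Gamma$ exactly one of the following holds: (1) precisely one of the three edges of $F$ is of second type (the other two being of first type); (2) all three edges of $F$ are of second type.
   Context: Let $M$ be a connected closed $2$-dimensional surface (not necessarily orientable) and $\Gamma$ a finite simple connected graph embedded in $M$ (vertices are points, edges are arcs homeomorphic to $[0,1]$, two edges are disjoint or meet in a common vertex). Faces are the closures of the connected components of $M\setminus\Gamma$; it is assumed that every face is homeomorphic to a closed disc, every edge lies in exactly two distinct faces, and two distinct faces intersect in an edge, a vertex, or not at all. $\Gamma$ is a triangulation if every face is a triangle. A zigzag is a sequence of vertices $(x_i)_{i\in\mathbb N}$ such that for every $i$: (Z1) $x_i,x_{i+1}$ are distinct vertices of an edge; (Z2) there is a unique face containing $x_i,x_{i+1},x_{i+2}$; (Z3) the faces containing $x_i,x_{i+1},x_{i+2}$ and $x_{i+1},x_{i+2},x_{i+3}$ are distinct. A zigzag is periodic, regarded as a cyclic sequence (one period), and identified with its shifts and with its reverse. $\Gamma$ is $z$-knotted if it has exactly one zigzag up to this identification. In a $z$-knotted graph the unique zigzag traverses every edge $\{x,y\}$ exactly twice (as consecutive entries in one period); the edge is of first type if the zigzag has the form $\dots,x,y,\dots,y,x,\dots$ (traversed once in each direction) and of second type if it has the form $\dots,x,y,\dots,x,y,\dots$ (traversed twice in the same direction). -}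

module Defs where

open import Data.Nat using (ℕ; zero; suc; _+_; _*_; _∸_; _<_)
open import Data.Fin using (Fin)
open import Data.Product using (Σ; ∃; _×_; _,_)
open import Data.Sum using (_⊎_)
open import Relation.Nullary using (¬_)
open import Relation.Binary.PropositionalEquality using (_≡_; _≢_)
open import Relation.Binary.Construct.Closure.ReflexiveTransitive using (Star)

record Triangulation : Set where
  field
    n m : ℕ
    v₁ v₂ v₃ : Fin m → Fin n

  _∈F_ : Fin n → Fin m → Set
  x ∈F f = (x ≡ v₁ f) ⊎ (x ≡ v₂ f) ⊎ (x ≡ v₃ f)

  IsEdge : Fin n → Fin n → Set
  IsEdge x y = (x ≢ y) × ∃ λ f → (x ∈F f) × (y ∈F f)

  Adj : Fin n → Fin n → Set
  Adj = IsEdge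

  AdjAround : Fin n → Fin m → Fin m → Set
  AdjAround x f g = (f ≢ g) × (x ∈F f) × (x ∈F g)
                    × ∃ λ w → (w ≢ x) × (w ∈F f) × (w ∈F g)

  field
    v₁≢v₂ : ∀ f → v₁ f ≢ v₂ f
    v₂≢v₃ : ∀ f → v₂ f ≢ v₃ f
    v₃≢v₁ : ∀ f → v₃ f ≢ v₁ f
    -- two distinct faces meet in an edge, a vertex, or not at all
    faces-meet : ∀ f g → f ≢ g → ¬ ((v₁ f ∈F g) × (v₂ f ∈F g) × (v₃ f ∈F g))
    edge-two-faces : ∀ x y → IsEdge x y →
      Σ (Fin m) λ f → Σ (Fin m) λ g → (f ≢ g)
        × (x ∈F f) × (y ∈F f) × (x ∈F g) × (y ∈F g)
        × (∀ h → x ∈F h → y ∈F h → (h ≡ f) ⊎ (h ≡ g))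
    vertex-on-face : ∀ x → ∃ λ f → x ∈F f
    -- surface condition: the faces around each vertex form a single cycle
    -- (the link of every vertex is connected)
    link-connected : ∀ x f g → x ∈F f → x ∈F g → Star (AdjAround x) f g
    -- the graph Γ (equivalently the surface M) is connected
    connected : ∀ x y → Star Adj x y

module _ (T : Triangulation) where
  open Triangulation T

  Contains3 : Fin n → Fin n → Fin n → Fin m → Set
  Contains3 x y w f = (x ∈F f) × (y ∈F f) × (w ∈F f)

  record IsZigzag (z : ℕ → Fin n) : Set where
    field
      Z1 : ∀ i → IsEdge (z i) (z (suc i))
      Z2 : ∀ i → Σ (Fin m) λ f → Contains3 (z i) (z (suc i)) (z (suc (suc i))) f
                   × (∀ g → Contains3 (z i) (z (suc i)) (z (suc (suc i))) g → g ≡ f)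
      Z3 : ∀ i f g → Contains3 (z i) (z (suc i)) (z (suc (suc i))) f
                   → Contains3 (z (suc i)) (z (suc (suc i))) (z (suc (suc (suc i)))) g
                   → f ≢ g

IsPeriod : {A : Set} → (ℕ → A) → ℕ → Set
IsPeriod z p = (0 < p) × (∀ i → z (p + i) ≡ z i)

IsMinPeriod : {A : Set} → (ℕ → A) → ℕ → Set
IsMinPeriod z p = IsPeriod z p × (∀ q → IsPeriod z q → p Data.Nat.≤ q)

-- z' is the same cyclic sequence as z up to a shift and/or reversal.
-- Reversal of a p-periodic sequence: i ↦ z (k - i) with indices mod p,
-- written as z (k + (p * (i+1) ∸ i)) to stay in ℕ.
SameZigzag : {A : Set} → (ℕ → A) → (ℕ → A) → Set
SameZigzag z' z =
  (∃ λ k → ∀ i → z' i ≡ z (k + i))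
  ⊎ (∃ λ p → IsPeriod z p × ∃ λ k → ∀ i → z' i ≡ z (k + (p * suc i ∸ i)))

FirstType : {A : Set} → (ℕ → A) → A → A → Set
FirstType z x y = (∃ λ i → (z i ≡ x) × (z (suc i) ≡ y))
                × (∃ λ j → (z j ≡ y) × (z (suc j) ≡ x))

SameDirTwice : {A : Set} → (ℕ → A) → A → A → Set
SameDirTwice z x y = ∃ λ p → IsMinPeriod z p × ∃ λ i → ∃ λ j → (i < j) × (j < p)
  × (z i ≡ x) × (z (suc i) ≡ y) × (z j ≡ x) × (z (suc j) ≡ y)

SecondType : {A : Set} → (ℕ → A) → A → A → Set
SecondType z x y = SameDirTwice z x y ⊎ SameDirTwice z y x

OneSecond : {A : Set} → (ℕ → A) → A → A → A → Set
OneSecond z a b c =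
    (SecondType z a b × FirstType z b c × FirstType z c a
       × ¬ SecondType z b c × ¬ SecondType z c a)
  ⊎ (SecondType z b c × FirstType z c a × FirstType z a b
       × ¬ SecondType z c a × ¬ SecondType z a b)
  ⊎ (SecondType z c a × FirstType z a b × FirstType z b c
       × ¬ SecondType z a b × ¬ SecondType z b c)

AllSecond : {A : Set} → (ℕ → A) → A → A → A → Set
AllSecond z a b c = SecondType z a b × SecondType z b c × SecondType z c a

FaceDichotomy : (T : Triangulation) → (ℕ → Fin (Triangulation.n T)) → Fin (Triangulation.m T) → Set
FaceDichotomy T z f =
  (OneSecond z a b c ⊎ AllSecond z a b c) × ¬ (OneSecond z a b c × AllSecond z a b c)
  where
  a = Triangulation.v₁ T f
  b = Triangulation.v₂ T f
  c = Triangulation.v₃ T f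

-- A zigzag of a triangulation is determined by any three consecutive vertices: the next vertex is
-- the apex of the other face on the last edge, and likewise backwards.  So for a face with vertices
-- l, c, r the zigzag starting l, c, r is, by z-knottedness, a shift or a reversal of z: either
-- (l, c, r) or (r, c, l) occurs in z, and never both, since a window and its mirror image would
-- force z to fold back on itself.  Every passage of z along an edge {x, y} of a face x y w runs
-- through that face or its neighbour, so it extends to the window (w, x, y) or (x, y, w).  Hence
-- {x, y} is of second type exactly when z passes the corners x and y with the same orientation
-- relative to the face; going around the triangle the orientation changes an even number of
-- times, so either no edge or exactly two edges are of first type.
module Submission where

open import Defs
open import Data.Nat using (ℕ)
open import Data.Fin using (Fin)

open import Data.Nat using (zero; suc; _+_; _*_; _∸_; _<_; _≤_; z≤n; s≤s)
open import Data.Nat.Properties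
  using (+-comm; +-assoc; +-suc; <-cmp; ≮⇒≥; <⇒≱; ≤-trans; ≤-total; m≤n+m; m≤n⇒∃[o]m+o≡n; m∸n+n≡m; _<?_; anyUpTo?)
open import Data.Nat.DivMod using (_%_; _/_; m≡m%n+[m/n]*n; m%n<n)
open import Data.Nat.Induction using (<-rec)
open import Data.Nat.Tactic.RingSolver using (solve-∀)
open import Data.Fin using (_≟_)
open import Data.Product using (∃; _×_; _,_; proj₁; proj₂)
open import Data.Sum using (_⊎_; inj₁; inj₂)
open import Data.Empty using (⊥; ⊥-elim)
open import Relation.Nullary using (¬_; yes; no)
open import Relation.Nullary.Decidable using (_×-dec_)
open import Relation.Unary using (Decidable)
open import Relation.Binary using (tri<; tri≈; tri>)
open import Relation.Binary.PropositionalEquality using (_≡_; _≢_; refl; sym; trans; cong; subst; ≢-sym)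
open Relation.Binary.PropositionalEquality.≡-Reasoning

module _ {A : Set} where

  Distinct₃ : A → A → A → Set
  Distinct₃ x y w = x ≢ y × y ≢ w × w ≢ x

  Distinct₃-rotate : ∀ {x y w} → Distinct₃ x y w → Distinct₃ y w x
  Distinct₃-rotate (x≢y , y≢w , w≢x) = y≢w , w≢x , x≢y

  Distinct₃-reverse : ∀ {x y w} → Distinct₃ x y w → Distinct₃ w y x
  Distinct₃-reverse (x≢y , y≢w , w≢x) = ≢-sym y≢w , ≢-sym x≢y , ≢-sym w≢x

  _∈⟨_∣_⟩ : A → A → A → Set
  x ∈⟨ a ∣ b ⟩ = x ≡ a ⊎ x ≡ b

  _∈⟨_∣_∣_⟩ : A → A → A → A → Set
  x ∈⟨ a ∣ b ∣ c ⟩ = x ≡ a ⊎ x ∈⟨ b ∣ c ⟩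

  ∈-rotate : ∀ {x a b c} → x ∈⟨ a ∣ b ∣ c ⟩ → x ∈⟨ b ∣ c ∣ a ⟩
  ∈-rotate (inj₁ x≡a) = inj₂ (inj₂ x≡a)
  ∈-rotate (inj₂ (inj₁ x≡b)) = inj₁ x≡b
  ∈-rotate (inj₂ (inj₂ x≡c)) = inj₂ (inj₁ x≡c)

  pigeonhole : ∀ {x y w a b} → x ∈⟨ a ∣ b ⟩ → y ∈⟨ a ∣ b ⟩ → w ∈⟨ a ∣ b ⟩ →
               x ≡ y ⊎ y ≡ w ⊎ w ≡ x
  pigeonhole (inj₁ refl) (inj₁ refl) _ = inj₁ refl
  pigeonhole (inj₂ refl) (inj₂ refl) _ = inj₁ refl
  pigeonhole _ (inj₁ refl) (inj₁ refl) = inj₂ (inj₁ refl)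
  pigeonhole _ (inj₂ refl) (inj₂ refl) = inj₂ (inj₁ refl)
  pigeonhole (inj₁ refl) _ (inj₁ refl) = inj₂ (inj₂ refl)
  pigeonhole (inj₂ refl) _ (inj₂ refl) = inj₂ (inj₂ refl)

  ¬Distinct₃-pair : ∀ {x y w a b} → x ∈⟨ a ∣ b ⟩ → y ∈⟨ a ∣ b ⟩ → w ∈⟨ a ∣ b ⟩ →
                    ¬ Distinct₃ x y w
  ¬Distinct₃-pair x∈ y∈ w∈ (x≢y , y≢w , w≢x) with pigeonhole x∈ y∈ w∈
  ... | inj₁ x≡y = x≢y x≡y
  ... | inj₂ (inj₁ y≡w) = y≢w y≡w
  ... | inj₂ (inj₂ w≡x) = w≢x w≡x

  ∈-cover : ∀ {x y w a b c} → Distinct₃ x y w →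
            x ∈⟨ a ∣ b ∣ c ⟩ → y ∈⟨ a ∣ b ∣ c ⟩ → w ∈⟨ a ∣ b ∣ c ⟩ → a ∈⟨ x ∣ y ∣ w ⟩
  ∈-cover _ (inj₁ refl) _ _ = inj₁ refl
  ∈-cover _ _ (inj₁ refl) _ = inj₂ (inj₁ refl)
  ∈-cover _ _ _ (inj₁ refl) = inj₂ (inj₂ refl)
  ∈-cover d (inj₂ x∈) (inj₂ y∈) (inj₂ w∈) = ⊥-elim (¬Distinct₃-pair x∈ y∈ w∈ d)

  ∈-⊆ : ∀ {x y w a b c v} → Distinct₃ x y w →
        x ∈⟨ a ∣ b ∣ c ⟩ → y ∈⟨ a ∣ b ∣ c ⟩ → w ∈⟨ a ∣ b ∣ c ⟩ →
        v ∈⟨ a ∣ b ∣ c ⟩ → v ∈⟨ x ∣ y ∣ w ⟩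
  ∈-⊆ d x∈ y∈ w∈ (inj₁ refl) = ∈-cover d x∈ y∈ w∈
  ∈-⊆ d x∈ y∈ w∈ (inj₂ (inj₁ refl)) = ∈-cover d (∈-rotate x∈) (∈-rotate y∈) (∈-rotate w∈)
  ∈-⊆ d x∈ y∈ w∈ (inj₂ (inj₂ refl)) =
    ∈-cover d (∈-rotate (∈-rotate x∈)) (∈-rotate (∈-rotate y∈)) (∈-rotate (∈-rotate w∈))

  third-unique : ∀ {x y w w' a b c} → Distinct₃ x y w → Distinct₃ x y w' →
                 x ∈⟨ a ∣ b ∣ c ⟩ → y ∈⟨ a ∣ b ∣ c ⟩ → w ∈⟨ a ∣ b ∣ c ⟩ → w' ∈⟨ a ∣ b ∣ c ⟩ →
                 w' ≡ w
  third-unique d (_ , y≢w' , w'≢x) x∈ y∈ w∈ w'∈ with ∈-⊆ d x∈ y∈ w∈ w'∈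
  ... | inj₁ w'≡x = ⊥-elim (w'≢x w'≡x)
  ... | inj₂ (inj₁ w'≡y) = ⊥-elim (y≢w' (sym w'≡y))
  ... | inj₂ (inj₂ w'≡w) = w'≡w

  third-exists : ∀ {x y a b c} → Distinct₃ a b c → x ∈⟨ a ∣ b ∣ c ⟩ → y ∈⟨ a ∣ b ∣ c ⟩ → x ≢ y →
                 ∃ λ w → w ∈⟨ a ∣ b ∣ c ⟩ × Distinct₃ x y w
  third-exists d (inj₁ refl) (inj₁ refl) x≢y = ⊥-elim (x≢y refl)
  third-exists d (inj₁ refl) (inj₂ (inj₁ refl)) _ = _ , inj₂ (inj₂ refl) , d
  third-exists d (inj₁ refl) (inj₂ (inj₂ refl)) _ = _ , inj₂ (inj₁ refl) , Distinct₃-reverse (Distinct₃-rotate d)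
  third-exists d (inj₂ (inj₁ refl)) (inj₁ refl) _ =
    _ , inj₂ (inj₂ refl) , Distinct₃-reverse (Distinct₃-rotate (Distinct₃-rotate d))
  third-exists d (inj₂ (inj₁ refl)) (inj₂ (inj₁ refl)) x≢y = ⊥-elim (x≢y refl)
  third-exists d (inj₂ (inj₁ refl)) (inj₂ (inj₂ refl)) _ = _ , inj₁ refl , Distinct₃-rotate d
  third-exists d (inj₂ (inj₂ refl)) (inj₁ refl) _ = _ , inj₂ (inj₁ refl) , Distinct₃-rotate (Distinct₃-rotate d)
  third-exists d (inj₂ (inj₂ refl)) (inj₂ (inj₁ refl)) _ = _ , inj₁ refl , Distinct₃-reverse d
  third-exists d (inj₂ (inj₂ refl)) (inj₂ (inj₂ refl)) x≢y = ⊥-elim (x≢y refl)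

module _ {A : Set} {s : ℕ → A} where

  IsPeriod-multiple : ∀ {p} → IsPeriod s p → ∀ k i → s (k * p + i) ≡ s i
  IsPeriod-multiple _ zero i = refl
  IsPeriod-multiple {p} per@(_ , shift) (suc k) i =
    trans (cong s (+-assoc p (k * p) i)) (trans (shift (k * p + i)) (IsPeriod-multiple per k i))

  IsPeriod-mod : ∀ {q} → IsPeriod s (suc q) → ∀ r i → s (r + i) ≡ s (r + i % suc q)
  IsPeriod-mod {q} per r i = begin
    s (r + i)                               ≡⟨ cong (λ j → s (r + j)) (m≡m%n+[m/n]*n i (suc q)) ⟩
    s (r + (i % suc q + i / suc q * suc q)) ≡⟨ cong s (rearrange r (i % suc q) (i / suc q * suc q)) ⟩
    s (i / suc q * suc q + (r + i % suc q)) ≡⟨ IsPeriod-multiple per (i / suc q) (r + i % suc q) ⟩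
    s (r + i % suc q)                       ∎
    where
    rearrange : ∀ a b c → a + (b + c) ≡ c + (a + b)
    rearrange = solve-∀

  IsPeriod-residue : ∀ {q x y} → IsPeriod s (suc q) → ∀ k → s k ≡ x → s (suc k) ≡ y →
                     s (k % suc q) ≡ x × s (suc (k % suc q)) ≡ y
  IsPeriod-residue per k e₀ e₁ = trans (sym (IsPeriod-mod per 0 k)) e₀ , trans (sym (IsPeriod-mod per 1 k)) e₁

least-witness : {P : ℕ → Set} → Decidable P → ∀ k → P k → ∃ λ m → P m × (∀ j → P j → m ≤ j)
least-witness {P} P? = <-rec _ search
  where
  search : ∀ k → (∀ {i} → i < k → P i → ∃ λ m → P m × (∀ j → P j → m ≤ j)) → P k →
           ∃ λ m → P m × (∀ j → P j → m ≤ j)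
  search k below Pk with anyUpTo? P? k
  ... | yes (i , i<k , Pi) = below i<k Pi
  ... | no none = k , Pk , λ j Pj → ≮⇒≥ λ j<k → none (j , j<k , Pj)

module Triangles (T : Triangulation) where
  open Triangulation T

  record Triangle (F : Fin m) (x y w : Fin n) : Set where
    constructor triangle
    field
      ∈₁ : x ∈F F
      ∈₂ : y ∈F F
      ∈₃ : w ∈F F
      distinct : Distinct₃ x y w

    contains : Contains3 T x y w F
    contains = ∈₁ , ∈₂ , ∈₃

  face-distinct : ∀ F → Distinct₃ (v₁ F) (v₂ F) (v₃ F)
  face-distinct F = v₁≢v₂ F , v₂≢v₃ F , v₃≢v₁ F

  face-triangle : ∀ F → Triangle F (v₁ F) (v₂ F) (v₃ F)
  face-triangle F = triangle (inj₁ refl) (inj₂ (inj₁ refl)) (inj₂ (inj₂ refl)) (face-distinct F)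

  Triangle-rotate : ∀ {F x y w} → Triangle F x y w → Triangle F y w x
  Triangle-rotate (triangle x∈ y∈ w∈ d) = triangle y∈ w∈ x∈ (Distinct₃-rotate d)

  Triangle-reverse : ∀ {F x y w} → Triangle F x y w → Triangle F w y x
  Triangle-reverse (triangle x∈ y∈ w∈ d) = triangle w∈ y∈ x∈ (Distinct₃-reverse d)

  third-vertex : ∀ {G y w} → y ∈F G → w ∈F G → y ≢ w → ∃ λ v → Triangle G y w v
  third-vertex {G} y∈ w∈ y≢w with third-exists (face-distinct G) y∈ w∈ y≢w
  ... | v , v∈ , d = v , triangle y∈ w∈ v∈ d

  face-unique : ∀ {F G x y w} → Triangle F x y w → Contains3 T x y w G → G ≡ F
  face-unique {F} {G} (triangle x∈ y∈ w∈ d) (x∈G , y∈G , w∈G) with G ≟ F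
  ... | yes G≡F = G≡F
  ... | no G≢F = ⊥-elim (faces-meet F G (≢-sym G≢F)
                   (shared (inj₁ refl) , shared (inj₂ (inj₁ refl)) , shared (inj₂ (inj₂ refl))))
    where
    shared : ∀ {v} → v ∈F F → v ∈F G
    shared v∈ with ∈-⊆ d x∈ y∈ w∈ v∈
    ... | inj₁ refl = x∈G
    ... | inj₂ (inj₁ refl) = y∈G
    ... | inj₂ (inj₂ refl) = w∈G

  at-most-two-faces : ∀ {x y A B C} → x ≢ y →
                      x ∈F A → y ∈F A → x ∈F B → y ∈F B → x ∈F C → y ∈F C →
                      A ≡ B ⊎ B ≡ C ⊎ C ≡ A
  at-most-two-faces x≢y x∈A y∈A x∈B y∈B x∈C y∈C with edge-two-faces _ _ (x≢y , _ , x∈A , y∈A)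
  ... | _ , _ , _ , _ , _ , _ , _ , on-edge =
    pigeonhole (on-edge _ x∈A y∈A) (on-edge _ x∈B y∈B) (on-edge _ x∈C y∈C)

  unique-face⇒w≢x : ∀ {F x y w} → IsEdge x y → (∀ G → Contains3 T x y w G → G ≡ F) → w ≢ x
  unique-face⇒w≢x xy unique refl with edge-two-faces _ _ xy
  ... | f , g , f≢g , x∈f , y∈f , x∈g , y∈g , _ =
    f≢g (trans (unique f (x∈f , y∈f , x∈f)) (sym (unique g (x∈g , y∈g , x∈g))))

  record Across (F : Fin m) (y w : Fin n) : Set where
    field
      {face} : Fin m
      {apex} : Fin n
      face≢F : face ≢ F
      triangle-across : Triangle face y w apex

  across : ∀ {F x y w} → Triangle F x y w → Across F y w
  across {F} (triangle _ y∈F w∈F (_ , y≢w , _)) with edge-two-faces _ _ (y≢w , F , y∈F , w∈F)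
  ... | f , g , f≢g , y∈f , w∈f , y∈g , w∈g , _ with F ≟ f
  ... | yes refl = record { face≢F = ≢-sym f≢g ; triangle-across = proj₂ (third-vertex y∈g w∈g y≢w) }
  ... | no F≢f = record { face≢F = ≢-sym F≢f ; triangle-across = proj₂ (third-vertex y∈f w∈f y≢w) }

  apex-unique : ∀ {F G G' x y w v v'} → Triangle F x y w →
                G ≢ F → Triangle G y w v → G' ≢ F → Triangle G' y w v' → v' ≡ v
  apex-unique (triangle _ y∈F w∈F _) G≢F (triangle y∈G w∈G v∈G dG) G'≢F (triangle y∈G' w∈G' v'∈G' dG')
    with at-most-two-faces (proj₁ dG) y∈F w∈F y∈G w∈G y∈G' w∈G'
  ... | inj₁ F≡G = ⊥-elim (G≢F (sym F≡G))
  ... | inj₂ (inj₁ refl) = third-unique dG dG' y∈G w∈G v∈G v'∈G'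
  ... | inj₂ (inj₂ G'≡F) = ⊥-elim (G'≢F G'≡F)

  record Turn (x y w v : Fin n) : Set where
    constructor turn
    field
      {F G} : Fin m
      F≢G : F ≢ G
      before : Triangle F x y w
      after : Triangle G y w v

  Turn-reverse : ∀ {x y w v} → Turn x y w v → Turn v w y x
  Turn-reverse (turn F≢G before after) = turn (≢-sym F≢G) (Triangle-reverse after) (Triangle-reverse before)

  Turn-deterministic : ∀ {x y w v x' y' w' v'} → Turn x y w v → Turn x' y' w' v' →
                       x ≡ x' → y ≡ y' → w ≡ w' → v ≡ v'
  Turn-deterministic (turn {F} F≢G before after) (turn {G = G'} F'≢G' before' after') refl refl refl =
    sym (apex-unique before (≢-sym F≢G) after G'≢F after')
    where
    G'≢F : G' ≢ F
    G'≢F G'≡F = F'≢G' (trans (face-unique before (Triangle.contains before')) (sym G'≡F))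

  Turn-x≢v : ∀ {x y w v} → Turn x y w v → x ≢ v
  Turn-x≢v (turn F≢G before (triangle y∈ w∈ v∈ _)) refl = F≢G (sym (face-unique before (v∈ , y∈ , w∈)))

module FlagZigzag (T : Triangulation) where
  open Triangulation T
  open Triangles T

  record Flag : Set where
    constructor flag
    field
      {face} : Fin m
      {x y w} : Fin n
      flag-triangle : Triangle face x y w

  next : Flag → Flag
  next (flag t) = flag (Across.triangle-across (across t))

  flags : Flag → ℕ → Flag
  flags φ zero = φ
  flags φ (suc k) = next (flags φ k)

  zigzagFrom : Flag → ℕ → Fin n
  zigzagFrom φ k = Flag.x (flags φ k)

  zigzagFrom-isZigzag : ∀ φ → IsZigzag T (zigzagFrom φ)
  zigzagFrom-isZigzag φ = record
    { Z1 = λ k → proj₁ (distinct (tri k)) , Flag.face (flags φ k) , ∈₁ (tri k) , ∈₂ (tri k)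
    ; Z2 = λ k → Flag.face (flags φ k) , contains (tri k) , λ _ → face-unique (tri k)
    ; Z3 = λ k _ _ cf cg f≡g → Across.face≢F (across (tri k))
             (trans (sym (face-unique (tri (suc k)) cg)) (trans (sym f≡g) (face-unique (tri k) cf)))
    }
    where
    open Triangle
    tri : ∀ k → Triangle (Flag.face (flags φ k)) (zigzagFrom φ k) (zigzagFrom φ (suc k)) (zigzagFrom φ (suc (suc k)))
    tri k = Flag.flag-triangle (flags φ k)

module Zigzag (T : Triangulation) (z : ℕ → Fin (Triangulation.n T)) (isZ : IsZigzag T z) where
  open Triangulation T
  open Triangles T
  open IsZigzag isZ

  face-at : ℕ → Fin m
  face-at u = proj₁ (Z2 u)

  triangle-at : ∀ u → Triangle (face-at u) (z u) (z (suc u)) (z (suc (suc u)))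
  triangle-at u with Z2 u
  ... | _ , (x∈ , y∈ , w∈) , unique =
    triangle x∈ y∈ w∈ (proj₁ (Z1 u) , proj₁ (Z1 (suc u)) , unique-face⇒w≢x (Z1 u) unique)

  turn-at : ∀ u → Turn (z u) (z (suc u)) (z (suc (suc u))) (z (suc (suc (suc u))))
  turn-at u = turn (Z3 u _ _ (Triangle.contains (triangle-at u)) (Triangle.contains (triangle-at (suc u))))
                   (triangle-at u) (triangle-at (suc u))

  SameWindow : ℕ → ℕ → Set
  SameWindow u v = z u ≡ z v × z (suc u) ≡ z (suc v) × z (suc (suc u)) ≡ z (suc (suc v))

  SameWindow-suc : ∀ {u v} → SameWindow u v → SameWindow (suc u) (suc v)
  SameWindow-suc {u} {v} (e₀ , e₁ , e₂) = e₁ , e₂ , Turn-deterministic (turn-at u) (turn-at v) e₀ e₁ e₂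

  SameWindow-pred : ∀ {u v} → SameWindow (suc u) (suc v) → SameWindow u v
  SameWindow-pred {u} {v} (e₁ , e₂ , e₃) =
    Turn-deterministic (Turn-reverse (turn-at u)) (Turn-reverse (turn-at v)) e₃ e₂ e₁ , e₁ , e₂

  SameWindow⇒period : ∀ u d → SameWindow u (u + d) → ∀ t → z (d + t) ≡ z t
  SameWindow⇒period u d same t = trans (cong z (+-comm d t)) (sym (proj₁ (forward (back u same) t)))
    where
    back : ∀ u → SameWindow u (u + d) → SameWindow 0 d
    back zero s = s
    back (suc u) s = back u (SameWindow-pred s)
    forward : SameWindow 0 d → ∀ t → SameWindow t (t + d)
    forward s zero = s
    forward s (suc t) = SameWindow-suc (forward s t)

  period⇒SameWindow : ∀ d → (∀ t → z (d + t) ≡ z t) → SameWindow 0 d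
  period⇒SameWindow d per = back 0 , back 1 , back 2
    where
    back : ∀ i → z i ≡ z (i + d)
    back i = sym (trans (cong z (+-comm i d)) (per i))

  MirrorWindow : ℕ → ℕ → Set
  MirrorWindow u v = z u ≡ z (suc (suc v)) × z (suc u) ≡ z (suc v) × z (suc (suc u)) ≡ z v

  -- Determinacy moves mirrored windows towards each other until they overlap, where z would
  -- either stall on an edge (d = 1) or return after two steps (d = 0).
  no-MirrorWindow : ∀ d u → ¬ MirrorWindow u (d + u)
  no-MirrorWindow zero u (_ , _ , e) = proj₂ (proj₂ (Triangle.distinct (triangle-at u))) e
  no-MirrorWindow (suc zero) u (_ , e , _) = proj₁ (proj₂ (Triangle.distinct (triangle-at u))) e
  no-MirrorWindow (suc (suc d)) u (e₀ , e₁ , e₂) =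
    no-MirrorWindow d (suc u) (subst (MirrorWindow (suc u)) (sym (+-suc d u)) (e₁ , e₂ , e₃))
    where
    e₃ : z (suc (suc (suc u))) ≡ z (suc (d + u))
    e₃ = Turn-deterministic (turn-at u) (Turn-reverse (turn-at (suc (d + u)))) e₀ e₁ e₂

  OccAt : Fin n → Fin n → Fin n → ℕ → Set
  OccAt l c r u = z u ≡ l × z (suc u) ≡ c × z (suc (suc u)) ≡ r

  Occ : Fin n → Fin n → Fin n → Set
  Occ l c r = ∃ (OccAt l c r)

  OccAt⇒SameWindow : ∀ {l c r u v} → OccAt l c r u → OccAt l c r v → SameWindow u v
  OccAt⇒SameWindow (a₀ , a₁ , a₂) (b₀ , b₁ , b₂) = trans a₀ (sym b₀) , trans a₁ (sym b₁) , trans a₂ (sym b₂)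

  occurs-not-both : ∀ {l c r} → Occ l c r → ¬ Occ r c l
  occurs-not-both (u , a₀ , a₁ , a₂) (v , b₀ , b₁ , b₂) with ≤-total u v
  ... | inj₁ u≤v = no-MirrorWindow _ u (subst (MirrorWindow u) (sym (m∸n+n≡m u≤v)) mirror)
    where
    mirror : MirrorWindow u v
    mirror = trans a₀ (sym b₂) , trans a₁ (sym b₁) , trans a₂ (sym b₀)
  ... | inj₂ v≤u = no-MirrorWindow _ v (subst (MirrorWindow v) (sym (m∸n+n≡m v≤u)) mirror)
    where
    mirror : MirrorWindow v u
    mirror = trans b₀ (sym a₂) , trans b₁ (sym a₁) , trans b₂ (sym a₀)

  -- The faces of z at t and t + 1 are the two faces through the edge, so one of them is F.
  passage : ∀ {F x y w t} → Triangle F x y w → z (suc t) ≡ x → z (suc (suc t)) ≡ y →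
            OccAt w x y t ⊎ OccAt x y w (suc t)
  passage {t = t} (triangle x∈ y∈ w∈ d) refl refl with triangle-at t | triangle-at (suc t)
  ... | triangle z₀∈ x∈₀ y∈₀ d₀ | triangle x∈₁ y∈₁ z₃∈ d₁ with at-most-two-faces (proj₁ d) x∈ y∈ x∈₀ y∈₀ x∈₁ y∈₁
  ... | inj₁ refl = inj₁ (third-unique d (Distinct₃-rotate d₀) x∈ y∈ w∈ z₀∈ , refl , refl)
  ... | inj₂ (inj₁ F₀≡F₁) = ⊥-elim (Turn.F≢G (turn-at t) F₀≡F₁)
  ... | inj₂ (inj₂ refl) = inj₂ (refl , refl , third-unique d d₁ x∈ y∈ w∈ z₃∈)

  no-repeat-within-period : ∀ {p l c r u d} → IsMinPeriod z p →
                            OccAt l c r u → OccAt l c r (u + d) → 0 < d → d < p → ⊥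
  no-repeat-within-period (_ , minimal) a b 0<d d<p =
    <⇒≱ d<p (minimal _ (0<d , SameWindow⇒period _ _ (OccAt⇒SameWindow a b)))

  not-same-direction : ∀ {F x y w} → Triangle F x y w → ¬ (Occ w x y × Occ x y w) → ¬ SameDirTwice z x y
  not-same-direction {x = x} {y} {w} tri not-both
    (suc q , mp@((_ , per) , _) , i , j , i<j , j<p , zi , zi₁ , zj , zj₁) with m≤n⇒∃[o]m+o≡n i<j
  ... | d , refl = combine (extend i zi zi₁) (extend (suc (i + d)) zj zj₁)
    where
    extend : ∀ k → z k ≡ x → z (suc k) ≡ y → OccAt w x y (q + k) ⊎ OccAt x y w (suc (q + k))
    extend k e₀ e₁ =
      passage tri (trans (per k) e₀) (trans (cong (λ h → z (suc h)) (sym (+-suc q k))) (trans (per (suc k)) e₁))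
    gap : q + suc (i + d) ≡ q + i + suc d
    gap = trans (+-suc q (i + d)) (trans (cong suc (sym (+-assoc q i d))) (sym (+-suc (q + i) d)))
    gap<p : suc d < suc q
    gap<p = ≤-trans (s≤s (s≤s (m≤n+m d i))) j<p
    combine : OccAt w x y (q + i) ⊎ OccAt x y w (suc (q + i)) →
              OccAt w x y (q + suc (i + d)) ⊎ OccAt x y w (suc (q + suc (i + d))) → ⊥
    combine (inj₁ a) (inj₁ b) = no-repeat-within-period mp a (subst (OccAt w x y) gap b) (s≤s z≤n) gap<p
    combine (inj₂ a) (inj₂ b) = no-repeat-within-period mp a (subst (OccAt x y w) (cong suc gap) b) (s≤s z≤n) gap<p
    combine (inj₁ a) (inj₂ b) = not-both ((_ , a) , (_ , b))
    combine (inj₂ a) (inj₁ b) = not-both ((_ , b) , (_ , a))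

  same-direction : ∀ {p x y w} → IsMinPeriod z p → Occ w x y → Occ x y w → SameDirTwice z x y
  same-direction {suc q} {w = w} mp@(per , _) (u , a₀ , a₁ , a₂) (u' , b₀ , b₁ , b₂)
    with <-cmp (suc u % suc q) (u' % suc q) | IsPeriod-residue per (suc u) a₁ a₂ | IsPeriod-residue per u' b₀ b₁
  ... | tri< lt _ _ | ex , ey | fx , fy = suc q , mp , _ , _ , lt , m%n<n u' (suc q) , ex , ey , fx , fy
  ... | tri> _ _ gt | ex , ey | fx , fy = suc q , mp , _ , _ , gt , m%n<n (suc u) (suc q) , fx , fy , ex , ey
  ... | tri≈ _ eq _ | _ | _ = ⊥-elim (Turn-x≢v (turn-at u) (trans a₀ (sym z₃≡w)))
    where
    z₃≡w : z (suc (suc (suc u))) ≡ w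
    z₃≡w = begin
      z (2 + suc u)            ≡⟨ IsPeriod-mod per 2 (suc u) ⟩
      z (2 + suc u % suc q)    ≡⟨ cong (λ i → z (2 + i)) eq ⟩
      z (2 + u' % suc q)       ≡⟨ IsPeriod-mod per 2 u' ⟨
      z (2 + u')               ≡⟨ b₂ ⟩
      w                        ∎

  period-window? : Decidable (λ d → 0 < d × SameWindow 0 d)
  period-window? d = (0 <? d) ×-dec (z 0 ≟ z d) ×-dec (z 1 ≟ z (suc d)) ×-dec (z 2 ≟ z (suc (suc d)))

  minimal-period : ∀ {p} → IsPeriod z p → ∃ (IsMinPeriod z)
  minimal-period {p} (0<p , per) with least-witness period-window? p (0<p , period⇒SameWindow p per)
  ... | d , (0<d , same) , least =
    d , (0<d , SameWindow⇒period 0 d same) , λ q (0<q , per-q) → least q (0<q , period⇒SameWindow q per-q)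

module ZKnotted (T : Triangulation) (z : ℕ → Fin (Triangulation.n T)) (isZ : IsZigzag T z)
                (unique : ∀ z' → IsZigzag T z' → SameZigzag z' z) where
  open Triangulation T
  open Triangles T
  open FlagZigzag T
  open Zigzag T z isZ

  shifted⇒Occ : ∀ {F l c r k} (t : Triangle F l c r) →
                (∀ i → zigzagFrom (flag t) i ≡ z (k + i)) → Occ l c r
  shifted⇒Occ {k = k} t eq = k , at 0 , at 1 , at 2
    where
    at : ∀ i → z (i + k) ≡ zigzagFrom (flag t) i
    at i = trans (cong z (+-comm i k)) (sym (eq i))

  -- z' 2, z' 1, z' 0 are read at k + 3p − 2, k + 2p − 1, k + p (p = suc q): consecutive up to multiples of p.
  reversed⇒Occ : ∀ {F l c r q k} (t : Triangle F l c r) → (∀ i → z (suc q + i) ≡ z i) →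
                 (∀ i → zigzagFrom (flag t) i ≡ z (k + (suc q * suc i ∸ i))) → Occ r c l
  reversed⇒Occ {q = q} {k} t per eq =
    k + suc (q * 3) ,
    sym (eq 2) ,
    trans (cong z (middle k q)) (trans (per _) (sym (eq 1))) ,
    trans (cong z (last k q)) (trans (per _) (trans (per _) (sym (eq 0))))
    where
    middle : ∀ k q → suc (k + suc (q * 3)) ≡ suc q + (k + suc (q * 2))
    middle = solve-∀
    last : ∀ k q → suc (suc (k + suc (q * 3))) ≡ suc q + (suc q + (k + suc (q * 1)))
    last = solve-∀

  occurs-or-reversed : ∀ {F l c r} → Triangle F l c r → Occ l c r ⊎ Occ r c l
  occurs-or-reversed t with unique _ (zigzagFrom-isZigzag (flag t))
  ... | inj₁ (_ , eq) = inj₁ (shifted⇒Occ t eq)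
  ... | inj₂ (suc _ , (_ , per) , _ , eq) = inj₂ (reversed⇒Occ t per eq)

  periodic : ∃ (IsPeriod z)
  periodic with unique _ (zigzagFrom-isZigzag (flag (Triangle-reverse (triangle-at 0))))
  ... | inj₁ (_ , eq) = ⊥-elim (occurs-not-both (0 , refl , refl , refl) (shifted⇒Occ _ eq))
  ... | inj₂ (p , per , _) = p , per

  min-period : ∃ (IsMinPeriod z)
  min-period = minimal-period (proj₂ periodic)

  -- Superscripts record how z passes the two corners x, y of the face x y w: ⁺ along the
  -- cyclic order (w, x, y), ⁻ against it.
  second⁺ : ∀ {x y w} → Occ w x y → Occ x y w → SecondType z x y
  second⁺ wxy xyw = inj₁ (same-direction (proj₂ min-period) wxy xyw)

  second⁻ : ∀ {x y w} → Occ y x w → Occ w y x → SecondType z x y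
  second⁻ yxw wyx = inj₂ (same-direction (proj₂ min-period) wyx yxw)

  not-second-type : ∀ {F x y w} → Triangle F x y w →
                    ¬ (Occ w x y × Occ x y w) → ¬ (Occ w y x × Occ y x w) → ¬ SecondType z x y
  not-second-type t h₁ _ (inj₁ s) = not-same-direction t h₁ s
  not-second-type t _ h₂ (inj₂ s) = not-same-direction (Triangle-rotate (Triangle-reverse t)) h₂ s

  FirstOnly : Fin n → Fin n → Set
  FirstOnly x y = FirstType z x y × ¬ SecondType z x y

  first⁺⁻ : ∀ {F x y w} → Triangle F x y w → Occ w x y → Occ w y x → FirstOnly x y
  first⁺⁻ t wxy@(u , _ , a₁ , a₂) wyx@(v , _ , b₁ , b₂) =
    ((suc u , a₁ , a₂) , (suc v , b₁ , b₂)) ,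
    not-second-type t (λ (_ , xyw) → occurs-not-both xyw wyx) (λ (_ , yxw) → occurs-not-both yxw wxy)

  first⁻⁺ : ∀ {F x y w} → Triangle F x y w → Occ y x w → Occ x y w → FirstOnly x y
  first⁻⁺ t yxw@(u , a₀ , a₁ , _) xyw@(v , b₀ , b₁ , _) =
    ((v , b₀ , b₁) , (u , a₀ , a₁)) ,
    not-second-type t (λ (wxy , _) → occurs-not-both wxy yxw) (λ (wyx , _) → occurs-not-both wyx xyw)

  one-second : ∀ {x y w} → SecondType z x y → FirstOnly y w → FirstOnly w x →
               SecondType z x y × FirstType z y w × FirstType z w x × ¬ SecondType z y w × ¬ SecondType z w x
  one-second s (f₁ , n₁) (f₂ , n₂) = s , f₁ , f₂ , n₁ , n₂

  face-dichotomy : ∀ {F a b c} → Triangle F a b c → OneSecond z a b c ⊎ AllSecond z a b c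
  face-dichotomy {F} {a} {b} {c} tab =
    classify (occurs-or-reversed tca) (occurs-or-reversed tab) (occurs-or-reversed tbc)
    where
    tbc : Triangle F b c a
    tbc = Triangle-rotate tab
    tca : Triangle F c a b
    tca = Triangle-rotate tbc
    classify : Occ c a b ⊎ Occ b a c → Occ a b c ⊎ Occ c b a → Occ b c a ⊎ Occ a c b →
               OneSecond z a b c ⊎ AllSecond z a b c
    classify (inj₁ A) (inj₁ B) (inj₁ C) = inj₂ (second⁺ A B , second⁺ B C , second⁺ C A)
    classify (inj₂ A) (inj₂ B) (inj₂ C) = inj₂ (second⁻ A B , second⁻ B C , second⁻ C A)
    classify (inj₁ A) (inj₁ B) (inj₂ C) = inj₁ (inj₁ (one-second (second⁺ A B) (first⁺⁻ tbc B C) (first⁻⁺ tca C A)))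
    classify (inj₂ A) (inj₂ B) (inj₁ C) = inj₁ (inj₁ (one-second (second⁻ A B) (first⁻⁺ tbc B C) (first⁺⁻ tca C A)))
    classify (inj₂ A) (inj₁ B) (inj₁ C) = inj₁ (inj₂ (inj₁ (one-second (second⁺ B C) (first⁺⁻ tca C A) (first⁻⁺ tab A B))))
    classify (inj₁ A) (inj₂ B) (inj₂ C) = inj₁ (inj₂ (inj₁ (one-second (second⁻ B C) (first⁻⁺ tca C A) (first⁺⁻ tab A B))))
    classify (inj₁ A) (inj₂ B) (inj₁ C) = inj₁ (inj₂ (inj₂ (one-second (second⁺ C A) (first⁺⁻ tab A B) (first⁻⁺ tbc B C))))
    classify (inj₂ A) (inj₁ B) (inj₂ C) = inj₁ (inj₂ (inj₂ (one-second (second⁻ C A) (first⁻⁺ tab A B) (first⁺⁻ tbc B C))))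

¬OneSecond×AllSecond : ∀ {A : Set} {z : ℕ → A} {a b c} → ¬ (OneSecond z a b c × AllSecond z a b c)
¬OneSecond×AllSecond (inj₁ (_ , _ , _ , ¬bc , _) , _ , bc , _) = ¬bc bc
¬OneSecond×AllSecond (inj₂ (inj₁ (_ , _ , _ , ¬ca , _)) , _ , _ , ca) = ¬ca ca
¬OneSecond×AllSecond (inj₂ (inj₂ (_ , _ , _ , ¬ab , _)) , ab , _ , _) = ¬ab ab

lemma1 : (T : Triangulation) → (z : ℕ → Fin (Triangulation.n T)) → IsZigzag T z
       → (∀ z' → IsZigzag T z' → SameZigzag z' z)
       → (f : Fin (Triangulation.m T)) → FaceDichotomy T z f
lemma1 T z isZ unique f = face-dichotomy (face-triangle f) , ¬OneSecond×AllSecond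
  where
  open Triangles T
  open ZKnotted T z isZ unique
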